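{- For an integer $p \geq 2$, let $T_p$ be the left comb tree on $2p-1$ vertices: it consists of a path $\pi_1, \pi_2, \dots, \pi_p$ together with $p-1$ additional vertices $\ell_1,\dots,\ell_{p-1}$, where $\ell_{i-1}$ is a leaf adjacent to $\pi_i$ for $i = 2,\dots,p$. Then the sandpile group $K(\mathrm{Cone}(T_p))$ is cyclic, i.e. $\mu(\mathrm{Cone}(T_p)) = 1$, while $T_p$ has $\ell(T_p) = p$ leaves.
   Context: For a graph $G$ on vertex set $\{v_1,\dots,v_n\}$, the cone $\mathrm{Cone}(G)$ is obtained by adding a new vertex $v_0$ and one edge $\{v_0,v_i\}$ for each $i$. For a connected graph $G$ with Laplacian $L_G = D - A$, the sandpile group $K(G)$ is the torsion subgroup of $\mathrm{coker}(L_G:\mathbb{Z}^V\to\mathbb{Z}^V)$, equivalently $\mathbb{Z}^{n-1}/\mathrm{im}(\overline{L_G})$ with $\overline{L_G}$ the reduced Laplacian obtained by deleting the row and column of one vertex. $\mu(G)$ denotes the minimal number of generators of the finite abelian group $K(G)$, and $\ell(T)$ denotes the number of leaves of a tree $T$. -}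

module Defs where

open import Data.Bool using (Bool; true; false; if_then_else_; _∧_; _∨_)
open import Data.Nat as ℕ using (ℕ; zero; suc; _≡ᵇ_; _<ᵇ_; _≤ᵇ_; _∸_)
open import Data.Integer as ℤ using (ℤ; +_; _-_; _*_)
open import Data.Fin using (Fin; zero; suc; toℕ; _≟_)
open import Data.Product using (Σ; ∃; _×_)
open import Relation.Nullary using (¬_; does)
open import Relation.Binary.PropositionalEquality using (_≡_)

-- A (loopless, undirected) graph on vertex set Fin n, given by a Boolean
-- adjacency relation.
Graph : ℕ → Set
Graph n = Fin n → Fin n → Bool

sumℤ : {n : ℕ} → (Fin n → ℤ) → ℤ
sumℤ {zero}  f = + 0
sumℤ {suc n} f = f zero ℤ.+ sumℤ (λ i → f (suc i))

sumℕ : {n : ℕ} → (Fin n → ℕ) → ℕ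
sumℕ {zero}  f = 0
sumℕ {suc n} f = f zero ℕ.+ sumℕ (λ i → f (suc i))

b2ℕ : Bool → ℕ
b2ℕ true  = 1
b2ℕ false = 0

deg : {n : ℕ} → Graph n → Fin n → ℕ
deg G v = sumℕ (λ u → b2ℕ (G v u))

numLeaves : {n : ℕ} → Graph n → ℕ
numLeaves G = sumℕ (λ v → b2ℕ (deg G v ≡ᵇ 1))

Cone : {n : ℕ} → Graph n → Graph (suc n)
Cone G zero    zero    = false
Cone G zero    (suc j) = true
Cone G (suc i) zero    = true
Cone G (suc i) (suc j) = G i j

Laplacian : {n : ℕ} → Graph n → Fin n → Fin n → ℤ
Laplacian G i j =
  (if does (i ≟ j) then + deg G i else + 0) - + b2ℕ (G i j)

reducedLaplacian : {n : ℕ} → Graph (suc n) → Fin n → Fin n → ℤ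
reducedLaplacian G i j = Laplacian G (suc i) (suc j)

InImage : {m : ℕ} → (Fin m → Fin m → ℤ) → (Fin m → ℤ) → Set
InImage {m} M x = Σ (Fin m → ℤ) λ y → (i : Fin m) → sumℤ (λ j → M i j * y j) ≡ x i

GeneratesCoker : {m k : ℕ} → (Fin m → Fin m → ℤ) → (Fin k → Fin m → ℤ) → Set
GeneratesCoker {m} {k} M gens =
  (x : Fin m → ℤ) → Σ (Fin k → ℤ) λ c →
    InImage M (λ i → x i - sumℤ (λ t → c t * gens t i))

-- The sandpile group K(G) of a connected graph G on Fin (suc n), realised as
-- ℤ^n / im(reduced Laplacian) (deleting vertex zero), is generated by k elements.
SandpileGeneratedBy : {n : ℕ} → Graph (suc n) → ℕ → Set
SandpileGeneratedBy {n} G k =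
  Σ (Fin k → Fin n → ℤ) λ gens → GeneratesCoker (reducedLaplacian G) gens

μ≡ : {n : ℕ} → Graph (suc n) → ℕ → Set
μ≡ G k = SandpileGeneratedBy G k × ((k' : ℕ) → k' ℕ.< k → ¬ SandpileGeneratedBy G k')

-- Left comb T_p on p + (p ∸ 1) = 2p-1 vertices (for p ≥ 1).
-- Vertex index a < p is the path vertex π_{a+1};
-- vertex index p + j (j < p-1) is the leaf ℓ_{j+1}, adjacent to π_{j+2} (index j+1).
combEdge : ℕ → ℕ → ℕ → Bool
combEdge p a b =
  ((suc a ≡ᵇ b) ∧ (b <ᵇ p)) ∨ ((p ≤ᵇ a) ∧ (b ≡ᵇ suc (a ∸ p)))

comb : (p : ℕ) → Graph (p ℕ.+ (p ∸ 1))
comb p i j = combEdge p (toℕ i) (toℕ j) ∨ combEdge p (toℕ j) (toℕ i)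

-- Cone(T) has reduced Laplacian L_T + I.  Given a target x, the row of each leaf
-- ℓ_{j+1} forces the value on its spine vertex π_{j+2} in terms of the value W_j on
-- the leaf.  Substituting into the rows of π₃, …, π_p leaves a tridiagonal system
-- (2 d_j - 1) W_j - 2 W_{j-1} - 2 W_{j+1} = R_j, where d_j = 1 + deg π_{j+2}, with
-- odd diagonal and W_{p-1} = 0.  Such a system is solvable over ℤ: solving it from
-- the top down, an odd kernel vector corrects the parity needed at each step.  The
-- row of π₂ then fixes the value at π₁, and the row of π₁ is matched by a multiple
-- of e_{π₁}, which therefore generates K.  K is not trivial: a preimage of e_{π₁}
-- would satisfy the rows 2 y_{π₁} - y_{π₂} = 1 of π₁ and 2 y_{ℓ₁} - y_{π₂} = 0 of ℓ₁,
-- whose difference is odd.  The leaves of T_p are π₁ and ℓ₁, …, ℓ_{p-1}; the other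
-- spine vertices have degree 2 or 3.

module Submission where

open import Defs
open import Data.Nat using (ℕ; _≤_)
open import Data.Product using (_×_)
open import Relation.Binary.PropositionalEquality using (_≡_)

open import Data.Bool using (Bool; true; false; T; _∧_; _∨_; if_then_else_)
open import Data.Bool.Properties using (∧-zeroʳ; ∧-comm; T-≡; T-∧; T-∨)
open import Data.Empty using (⊥; ⊥-elim)
open import Data.Fin using (Fin; zero; suc; toℕ; _≟_; _↑ʳ_)
import Data.Fin.Properties as Finₚ
open import Data.Integer as ℤ using (ℤ; +_; -[1+_]; _+_; _-_; _*_)
import Data.Integer.Properties as ℤₚ
open import Algebra.Properties.Ring ℤₚ.+-*-ring using ([y-z]x≈yx-zx)
open import Algebra.Properties.CommutativeSemigroup ℤₚ.+-commutativeSemigroup using (interchange)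
open import Data.Integer.Tactic.RingSolver using (solve-∀)
open import Data.Nat as ℕ using (zero; suc; _<_; _≡ᵇ_; _<ᵇ_; _≤ᵇ_; _∸_; z≤n; s≤s; z<s; s<s)
import Data.Nat.Properties as ℕₚ
open import Data.Product using (Σ; _,_; proj₁; proj₂)
open import Data.Sum using (_⊎_; inj₁; inj₂)
open import Function using (_∘_; Equivalence)
open import Relation.Binary.PropositionalEquality
  using (_≢_; refl; sym; trans; cong; cong₂; subst; module ≡-Reasoning)
open import Relation.Nullary using (¬_; does; yes; no)

[_] : Bool → ℤ
[ b ] = + b2ℕ b

[∨]-disjoint : ∀ x y → (T x → T y → ⊥) → [ x ∨ y ] ≡ [ x ] + [ y ]
[∨]-disjoint true  true  x∧y = ⊥-elim (x∧y _ _)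
[∨]-disjoint true  false _   = refl
[∨]-disjoint false y     _   = sym (ℤₚ.+-identityˡ [ y ])

[∧]-* : ∀ x y z → [ x ∧ y ] * z ≡ [ x ] * ([ y ] * z)
[∧]-* true  y z = sym (ℤₚ.*-identityˡ ([ y ] * z))
[∧]-* false y z = refl

≡ᵇ-sym : ∀ m n → (m ≡ᵇ n) ≡ (n ≡ᵇ m)
≡ᵇ-sym zero    zero    = refl
≡ᵇ-sym zero    (suc n) = refl
≡ᵇ-sym (suc m) zero    = refl
≡ᵇ-sym (suc m) (suc n) = ≡ᵇ-sym m n

≤ᵇ-∧-≡ᵇ-∸ : ∀ p b a → ((p ≤ᵇ b) ∧ (a ≡ᵇ b ∸ p)) ≡ (p ℕ.+ a ≡ᵇ b)
≤ᵇ-∧-≡ᵇ-∸ zero          b       a = refl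
≤ᵇ-∧-≡ᵇ-∸ (suc zero)    zero    a = refl
≤ᵇ-∧-≡ᵇ-∸ (suc (suc p)) zero    a = refl
≤ᵇ-∧-≡ᵇ-∸ (suc zero)    (suc b) a = ≤ᵇ-∧-≡ᵇ-∸ zero b a
≤ᵇ-∧-≡ᵇ-∸ (suc (suc p)) (suc b) a = ≤ᵇ-∧-≡ᵇ-∸ (suc p) b a

<ᵇ-true : ∀ {m n} → m < n → (m <ᵇ n) ≡ true
<ᵇ-true m<n = Equivalence.to T-≡ (ℕₚ.<⇒<ᵇ m<n)

<ᵇ-false : ∀ {m n} → n ≤ m → (m <ᵇ n) ≡ false
<ᵇ-false {m} {n} n≤m with m <ᵇ n in eq
... | false = refl
... | true  = ⊥-elim (ℕₚ.<⇒≱ (ℕₚ.<ᵇ⇒< m n (subst T (sym eq) _)) n≤m)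

2*-≢-1 : ∀ z → + 2 * z ≢ + 1
2*-≢-1 (+ zero)  ()
2*-≢-1 (+ suc m) 2m+2≡1 = ℕₚ.m+1+n≢0 m (ℕₚ.suc-injective (ℤₚ.+-injective 2m+2≡1))
2*-≢-1 -[1+ m ]  ()

≤ᵇ-true : ∀ {m n} → m ≤ n → (m ≤ᵇ n) ≡ true
≤ᵇ-true m≤n = Equivalence.to T-≡ (ℕₚ.≤⇒≤ᵇ m≤n)

≤ᵇ-false : ∀ {m n} → n < m → (m ≤ᵇ n) ≡ false
≤ᵇ-false {suc m} (s≤s n≤m) = <ᵇ-false n≤m

sumℤ-cong : ∀ {n} {f g : Fin n → ℤ} → (∀ i → f i ≡ g i) → sumℤ f ≡ sumℤ g
sumℤ-cong {zero}  f≗g = refl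
sumℤ-cong {suc n} f≗g = cong₂ _+_ (f≗g zero) (sumℤ-cong (f≗g ∘ suc))

sumℤ-zero : ∀ n → sumℤ {n} (λ _ → + 0) ≡ + 0
sumℤ-zero zero    = refl
sumℤ-zero (suc n) = trans (ℤₚ.+-identityˡ _) (sumℤ-zero n)

sumℤ-+ : ∀ {n} (f g : Fin n → ℤ) → sumℤ (λ i → f i + g i) ≡ sumℤ f + sumℤ g
sumℤ-+ {zero}  f g = refl
sumℤ-+ {suc n} f g = trans (cong (_+_ (f zero + g zero)) (sumℤ-+ (f ∘ suc) (g ∘ suc)))
                           (interchange (f zero) (g zero) (sumℤ (f ∘ suc)) (sumℤ (g ∘ suc)))

sumℤ-neg : ∀ {n} (f : Fin n → ℤ) → sumℤ (λ i → ℤ.- f i) ≡ ℤ.- sumℤ f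
sumℤ-neg {zero}  f = refl
sumℤ-neg {suc n} f = trans (cong (_+_ (ℤ.- f zero)) (sumℤ-neg (f ∘ suc)))
                           (sym (ℤₚ.neg-distrib-+ (f zero) (sumℤ (f ∘ suc))))

sumℤ-sub : ∀ {n} (f g : Fin n → ℤ) → sumℤ (λ i → f i - g i) ≡ sumℤ f - sumℤ g
sumℤ-sub f g = trans (sumℤ-+ f (ℤ.-_ ∘ g)) (cong (_+_ (sumℤ f)) (sumℤ-neg g))

sumℤ-*ˡ : ∀ {n} c (f : Fin n → ℤ) → sumℤ (λ i → c * f i) ≡ c * sumℤ f
sumℤ-*ˡ {zero}  c f = sym (ℤₚ.*-zeroʳ c)
sumℤ-*ˡ {suc n} c f = trans (cong (_+_ (c * f zero)) (sumℤ-*ˡ c (f ∘ suc)))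
                            (sym (ℤₚ.*-distribˡ-+ c (f zero) (sumℤ (f ∘ suc))))

sumℤ-diagonal : ∀ {n} (i : Fin n) c (y : Fin n → ℤ) →
                sumℤ (λ j → (if does (i ≟ j) then c else + 0) * y j) ≡ c * y i
sumℤ-diagonal {suc n} zero    c y = trans (cong (_+_ (c * y zero)) (sumℤ-zero n)) (ℤₚ.+-identityʳ _)
sumℤ-diagonal {suc n} (suc i) c y = trans (ℤₚ.+-identityˡ _) (sumℤ-diagonal i c (y ∘ suc))

+-sumℕ : ∀ {n} (f : Fin n → ℕ) → + sumℕ f ≡ sumℤ (λ i → + f i)
+-sumℕ {zero}  f = refl
+-sumℕ {suc n} f = trans (ℤₚ.pos-+ (f zero) (sumℕ (f ∘ suc))) (cong (_+_ (+ f zero)) (+-sumℕ (f ∘ suc)))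

sumℕ-cong : ∀ {n} {f g : Fin n → ℕ} → (∀ i → f i ≡ g i) → sumℕ f ≡ sumℕ g
sumℕ-cong {zero}  f≗g = refl
sumℕ-cong {suc n} f≗g = cong₂ ℕ._+_ (f≗g zero) (sumℕ-cong (f≗g ∘ suc))

sumℕ-const : ∀ n c → sumℕ {n} (λ _ → c) ≡ n ℕ.* c
sumℕ-const zero    c = refl
sumℕ-const (suc n) c = cong (c ℕ.+_) (sumℕ-const n c)

sumℕ-split : ∀ m {k} (F : ℕ → ℕ) →
  sumℕ {m ℕ.+ k} (F ∘ toℕ) ≡ sumℕ {m} (F ∘ toℕ) ℕ.+ sumℕ {k} (λ v → F (m ℕ.+ toℕ v))
sumℕ-split zero    F = refl
sumℕ-split (suc m) F = trans (cong (F 0 ℕ.+_) (sumℕ-split m (F ∘ suc))) (sym (ℕₚ.+-assoc (F 0) _ _))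

sumOver : ℕ → (ℕ → Bool) → (ℕ → ℤ) → ℤ
sumOver n E Y = sumℤ {n} (λ b → [ E (toℕ b) ] * Y (toℕ b))

sumOver-∨ : ∀ n (E F : ℕ → Bool) (Y : ℕ → ℤ) → (∀ b → T (E b) → T (F b) → ⊥) →
            sumOver n (λ b → E b ∨ F b) Y ≡ sumOver n E Y + sumOver n F Y
sumOver-∨ n E F Y disjoint = trans
  (sumℤ-cong {n} λ b → trans (cong (_* Y (toℕ b)) ([∨]-disjoint (E (toℕ b)) (F (toℕ b)) (disjoint (toℕ b))))
                             (ℤₚ.*-distribʳ-+ (Y (toℕ b)) [ E (toℕ b) ] [ F (toℕ b) ]))
  (sumℤ-+ {n} _ _)

sumOver-cong : ∀ n (E F : ℕ → Bool) (Y : ℕ → ℤ) → (∀ b → E b ≡ F b) → sumOver n E Y ≡ sumOver n F Y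
sumOver-cong n E F Y E≗F = sumℤ-cong {n} λ b → cong (λ e → [ e ] * Y (toℕ b)) (E≗F (toℕ b))

sumOver-∧ : ∀ n (E F : ℕ → Bool) (Y : ℕ → ℤ) →
            sumOver n (λ b → E b ∧ F b) Y ≡ sumOver n E (λ b → [ F b ] * Y b)
sumOver-∧ n E F Y = sumℤ-cong {n} λ b → [∧]-* (E (toℕ b)) (F (toℕ b)) (Y (toℕ b))

sumOver-guard : ∀ n g (E : ℕ → Bool) (Y : ℕ → ℤ) → sumOver n (λ b → g ∧ E b) Y ≡ [ g ] * sumOver n E Y
sumOver-guard n g E Y = trans (sumℤ-cong {n} λ b → [∧]-* g (E (toℕ b)) (Y (toℕ b))) (sumℤ-*ˡ {n} [ g ] _)

sumOver-δ : ∀ n k (Y : ℕ → ℤ) → sumOver n (k ≡ᵇ_) Y ≡ [ k <ᵇ n ] * Y k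
sumOver-δ zero    k       Y = refl
sumOver-δ (suc n) zero    Y = trans (cong (_+_ (+ 1 * Y 0)) (sumℤ-zero n)) (ℤₚ.+-identityʳ _)
sumOver-δ (suc n) (suc k) Y = trans (ℤₚ.+-identityˡ _) (sumOver-δ n k (Y ∘ suc))

zeroExtend : ∀ {n} → (Fin n → ℤ) → ℕ → ℤ
zeroExtend {zero}  f a       = + 0
zeroExtend {suc n} f zero    = f zero
zeroExtend {suc n} f (suc a) = zeroExtend (f ∘ suc) a

zeroExtend-toℕ : ∀ {n} (f : Fin n → ℤ) i → zeroExtend f (toℕ i) ≡ f i
zeroExtend-toℕ {suc n} f zero    = refl
zeroExtend-toℕ {suc n} f (suc i) = zeroExtend-toℕ (f ∘ suc) i

zeroExtend-≥ : ∀ {n} (f : Fin n → ℤ) {a} → n ≤ a → zeroExtend f a ≡ + 0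
zeroExtend-≥ {zero}  f         n≤a       = refl
zeroExtend-≥ {suc n} f {suc a} (s≤s n≤a) = zeroExtend-≥ (f ∘ suc) n≤a

coneReducedLaplacian-row : ∀ {n} (G : Graph n) i (y : Fin n → ℤ) →
  sumℤ (λ j → reducedLaplacian (Cone G) i j * y j)
    ≡ + suc (deg G i) * y i - sumℤ (λ j → [ G i j ] * y j)
coneReducedLaplacian-row {n} G i y = begin
  sumℤ (λ j → (diagonal j - [ G i j ]) * y j)
    ≡⟨ sumℤ-cong (λ j → [y-z]x≈yx-zx (y j) (diagonal j) [ G i j ]) ⟩
  sumℤ (λ j → diagonal j * y j - [ G i j ] * y j)
    ≡⟨ sumℤ-sub (λ j → diagonal j * y j) (λ j → [ G i j ] * y j) ⟩
  sumℤ (λ j → diagonal j * y j) - sumℤ (λ j → [ G i j ] * y j)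
    ≡⟨ cong (_- sumℤ (λ j → [ G i j ] * y j)) (sumℤ-diagonal i (+ suc (deg G i)) y) ⟩
  + suc (deg G i) * y i - sumℤ (λ j → [ G i j ] * y j)  ∎
  where
  open ≡-Reasoning
  diagonal : Fin n → ℤ
  diagonal j = if does (i ≟ j) then + suc (deg G i) else + 0

Odd : ℤ → Set
Odd z = Σ ℤ λ e → z ≡ + 1 + + 2 * e

odd-*-even : ∀ {a b} → Odd a → Odd b → ∀ c → Odd (a * b - + 2 * c)
odd-*-even (e , refl) (f , refl) c = e + f + + 2 * e * f - c , identity e f c
  where
  identity : ∀ e f c → (+ 1 + + 2 * e) * (+ 1 + + 2 * f) - + 2 * c
                       ≡ + 1 + + 2 * (e + f + + 2 * e * f - c)
  identity = solve-∀

odd-correction : ∀ {d z} → Odd d → Odd z → ∀ u r → Σ ℤ λ t → d * (u + (r - u) * z) - r ≡ + 2 * t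
odd-correction (f , refl) (e , refl) u r = f * r + e * (r - u) * (+ 1 + + 2 * f) , identity f e u r
  where
  identity : ∀ f e u r → (+ 1 + + 2 * f) * (u + (r - u) * (+ 1 + + 2 * e)) - r
                         ≡ + 2 * (f * r + e * (r - u) * (+ 1 + + 2 * f))
  identity = solve-∀

infixr 5 _◂_
_◂_ : ℤ → (ℕ → ℤ) → ℕ → ℤ
(a ◂ W) zero    = a
(a ◂ W) (suc i) = W i

TridiagonalRow : (D R W : ℕ → ℤ) → ℕ → Set
TridiagonalRow D R W i = D i * W (suc i) - + 2 * W i - + 2 * W (suc (suc i)) ≡ R i

SolvesTridiagonal : ℕ → (D R W : ℕ → ℤ) → Set
SolvesTridiagonal m D R W = W (suc m) ≡ + 0 × (∀ i → i < m → TridiagonalRow D R W i)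

zeros : ℕ → ℤ
zeros _ = + 0

row-combine : ∀ {D R P Z i} s → TridiagonalRow D R P i → TridiagonalRow D zeros Z i →
              TridiagonalRow D R (λ k → P k + s * Z k) i
row-combine {D} {R} {P} {Z} {i} s P-row Z-row = begin
  D i * (P (suc i) + s * Z (suc i)) - + 2 * (P i + s * Z i) - + 2 * (P (suc (suc i)) + s * Z (suc (suc i)))
    ≡⟨ expand (D i) (P i) (P (suc i)) (P (suc (suc i))) (Z i) (Z (suc i)) (Z (suc (suc i))) s ⟩
  (D i * P (suc i) - + 2 * P i - + 2 * P (suc (suc i))) + s * (D i * Z (suc i) - + 2 * Z i - + 2 * Z (suc (suc i)))
    ≡⟨ cong₂ (λ a b → a + s * b) P-row Z-row ⟩
  R i + s * + 0
    ≡⟨ cong (_+_ (R i)) (ℤₚ.*-zeroʳ s) ⟩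
  R i + + 0
    ≡⟨ ℤₚ.+-identityʳ (R i) ⟩
  R i ∎
  where
  open ≡-Reasoning
  expand : ∀ d p₀ p₁ p₂ z₀ z₁ z₂ s →
    d * (p₁ + s * z₁) - + 2 * (p₀ + s * z₀) - + 2 * (p₂ + s * z₂)
      ≡ (d * p₁ - + 2 * p₀ - + 2 * p₂) + s * (d * z₁ - + 2 * z₀ - + 2 * z₂)
  expand = solve-∀

row-double : ∀ {D Z i} → TridiagonalRow D zeros Z i → TridiagonalRow D zeros (λ k → + 2 * Z k) i
row-double {D} {Z} {i} Z-row = trans (factor (D i) (Z i) (Z (suc i)) (Z (suc (suc i)))) (cong (_*_ (+ 2)) Z-row)
  where
  factor : ∀ d z₀ z₁ z₂ → d * (+ 2 * z₁) - + 2 * (+ 2 * z₀) - + 2 * (+ 2 * z₂)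
                          ≡ + 2 * (d * z₁ - + 2 * z₀ - + 2 * z₂)
  factor = solve-∀

-- Adding a new row at the bottom: the kernel vector Z with Z 0 odd fixes the parity
-- of the particular solution so that the new row can be solved for its new entry,
-- and 2 Z extended by an odd entry is the new kernel vector.
tridiagonal-odd-kernel : ∀ m D R → (∀ i → Odd (D i)) →
  Σ (ℕ → ℤ) λ P → Σ (ℕ → ℤ) λ Z →
    SolvesTridiagonal m D R P × SolvesTridiagonal m D zeros Z × Odd (Z 0)
tridiagonal-odd-kernel zero    D R odd = zeros , (+ 1 ◂ zeros) , (refl , λ _ ()) , (refl , λ _ ()) , (+ 0 , refl)
tridiagonal-odd-kernel (suc m) D R odd
  with tridiagonal-odd-kernel m (D ∘ suc) (R ∘ suc) (odd ∘ suc)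
... | P , Z , (P-end , P-rows) , (Z-end , Z-rows) , Z₀-odd =
  P′ , Z′ , (P′-end , P′-rows) , (Z′-end , Z′-rows) , odd-*-even (odd 0) Z₀-odd (Z 1)
  where
  s : ℤ
  s = R 0 - P 0
  Q : ℕ → ℤ
  Q k = P k + s * Z k
  t : ℤ
  t = proj₁ (odd-correction (odd 0) Z₀-odd (P 0) (R 0))
  P′ Z′ : ℕ → ℤ
  P′ = (t - Q 1) ◂ Q
  Z′ = (D 0 * Z 0 - + 2 * Z 1) ◂ (λ k → + 2 * Z k)

  P′-end : P′ (suc (suc m)) ≡ + 0
  P′-end = trans (cong₂ (λ a b → a + s * b) P-end Z-end) (trans (ℤₚ.+-identityˡ (s * + 0)) (ℤₚ.*-zeroʳ s))

  Z′-end : Z′ (suc (suc m)) ≡ + 0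
  Z′-end = cong (_*_ (+ 2)) Z-end

  P′-rows : ∀ i → i < suc m → TridiagonalRow D R P′ i
  P′-rows zero    _         = first-row (D 0 * Q 0) (R 0) t (Q 1) (proj₂ (odd-correction (odd 0) Z₀-odd (P 0) (R 0)))
    where
    first-row : ∀ a r t u → a - r ≡ + 2 * t → a - + 2 * (t - u) - + 2 * u ≡ r
    first-row a r t u a-r≡2t = begin
      a - + 2 * (t - u) - + 2 * u ≡⟨ regroup a r t u ⟩
      (a - r) - + 2 * t + r       ≡⟨ cong (λ e → e - + 2 * t + r) a-r≡2t ⟩
      + 2 * t - + 2 * t + r       ≡⟨ cancel t r ⟩
      r                           ∎
      where
      open ≡-Reasoning
      regroup : ∀ a r t u → a - + 2 * (t - u) - + 2 * u ≡ (a - r) - + 2 * t + r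
      regroup = solve-∀
      cancel : ∀ t r → + 2 * t - + 2 * t + r ≡ r
      cancel = solve-∀
  P′-rows (suc i) (s<s i<m) = row-combine {D ∘ suc} {R ∘ suc} {P} {Z} s (P-rows i i<m) (Z-rows i i<m)

  Z′-rows : ∀ i → i < suc m → TridiagonalRow D zeros Z′ i
  Z′-rows zero    _         = cancel (D 0) (Z 0) (Z 1)
    where
    cancel : ∀ d z₀ z₁ → d * (+ 2 * z₀) - + 2 * (d * z₀ - + 2 * z₁) - + 2 * (+ 2 * z₁) ≡ + 0
    cancel = solve-∀
  Z′-rows (suc i) (s<s i<m) = row-double {D ∘ suc} {Z} (Z-rows i i<m)

tridiagonal-solvable : ∀ m D R → (∀ i → Odd (D i)) → Σ (ℕ → ℤ) (SolvesTridiagonal m D R)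
tridiagonal-solvable m D R odd = let P , _ , P-solves , _ = tridiagonal-odd-kernel m D R odd in P , P-solves

module Comb (q : ℕ) where

  p n : ℕ
  p = suc (suc q)
  n = p ℕ.+ suc q

  spine<p : ∀ {j} → j ≤ q → suc j < p
  spine<p j≤q = s≤s (s≤s j≤q)

  p<n : p < n
  p<n = ℕₚ.m<m+n p z<s

  <p⇒<n : ∀ {a} → a < p → a < n
  <p⇒<n a<p = ℕₚ.<-trans a<p p<n

  leaf<n : ∀ {j} → j ≤ q → p ℕ.+ j < n
  leaf<n j≤q = ℕₚ.+-monoʳ-< p (s≤s j≤q)

  -- combEdge p a b = pathEdge a b ∨ leafEdge a b: b is the parent of a in T_p rooted at π_p.
  pathEdge leafEdge : ℕ → ℕ → Bool
  pathEdge a b = (suc a ≡ᵇ b) ∧ (b <ᵇ p)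
  leafEdge a b = (p ≤ᵇ a) ∧ (b ≡ᵇ suc (a ∸ p))

  pathEdge-forward : ∀ a b → T (pathEdge a b) → a < b × b < p
  pathEdge-forward a b e with Equivalence.to T-∧ e
  ... | a+1≡b , b<p = subst (a <_) (ℕₚ.≡ᵇ⇒≡ (suc a) b a+1≡b) ℕₚ.≤-refl , ℕₚ.<ᵇ⇒< b p b<p

  leafEdge-backward : ∀ a b → T (leafEdge a b) → p ≤ a × b < a
  leafEdge-backward a b e with Equivalence.to T-∧ e
  ... | p≤a , b≡ = p≤a′ , subst (_< a) (sym (ℕₚ.≡ᵇ⇒≡ b (suc (a ∸ p)) b≡)) (begin
      suc (suc (a ∸ p)) ≤⟨ ℕₚ.+-monoˡ-≤ (a ∸ p) (s≤s (s≤s (z≤n {q}))) ⟩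
      p ℕ.+ (a ∸ p)     ≡⟨ ℕₚ.m+[n∸m]≡n p≤a′ ⟩
      a                 ∎)
    where
    open ℕₚ.≤-Reasoning
    p≤a′ : p ≤ a
    p≤a′ = ℕₚ.≤ᵇ⇒≤ p a p≤a

  combEdge-oriented : ∀ a b → T (combEdge p a b) → (a < b × b < p) ⊎ (p ≤ a × b < a)
  combEdge-oriented a b e with Equivalence.to T-∨ e
  ... | inj₁ path = inj₁ (pathEdge-forward a b path)
  ... | inj₂ leaf = inj₂ (leafEdge-backward a b leaf)

  pathEdge-leafEdge-disjoint : ∀ a b → T (pathEdge a b) → T (leafEdge a b) → ⊥
  pathEdge-leafEdge-disjoint a b path leaf with pathEdge-forward a b path | leafEdge-backward a b leaf
  ... | a<b , b<p | p≤a , _ = ℕₚ.<⇒≱ (ℕₚ.<-trans a<b b<p) p≤a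

  combEdge-asymmetric : ∀ a b → T (combEdge p a b) → T (combEdge p b a) → ⊥
  combEdge-asymmetric a b ab ba with combEdge-oriented a b ab | combEdge-oriented b a ba
  ... | inj₁ (a<b , _)   | inj₁ (b<a , _)   = ℕₚ.<-asym a<b b<a
  ... | inj₁ (_   , b<p) | inj₂ (p≤b , _)   = ℕₚ.<⇒≱ b<p p≤b
  ... | inj₂ (p≤a , _)   | inj₁ (_   , a<p) = ℕₚ.<⇒≱ a<p p≤a
  ... | inj₂ (_   , b<a) | inj₂ (_   , a<b) = ℕₚ.<-asym a<b b<a

  adjacent : ℕ → ℕ → Bool
  adjacent a b = combEdge p a b ∨ combEdge p b a

  neighbourSum parentSum childSum : ℕ → (ℕ → ℤ) → ℤ
  neighbourSum a = sumOver n (adjacent a)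
  parentSum    a = sumOver n (combEdge p a)
  childSum     a = sumOver n (λ b → combEdge p b a)

  neighbourSum-split : ∀ a Y → neighbourSum a Y ≡ parentSum a Y + childSum a Y
  neighbourSum-split a Y = sumOver-∨ n (combEdge p a) (λ b → combEdge p b a) Y (combEdge-asymmetric a)

  parentSum-eval : ∀ a Y → parentSum a Y ≡
    [ suc a <ᵇ n ] * ([ suc a <ᵇ p ] * Y (suc a)) + [ p ≤ᵇ a ] * ([ suc (a ∸ p) <ᵇ n ] * Y (suc (a ∸ p)))
  parentSum-eval a Y = begin
    parentSum a Y
      ≡⟨ sumOver-∨ n (pathEdge a) (leafEdge a) Y (pathEdge-leafEdge-disjoint a) ⟩
    sumOver n (pathEdge a) Y + sumOver n (leafEdge a) Y
      ≡⟨ cong₂ _+_ (sumOver-∧ n (suc a ≡ᵇ_) (_<ᵇ p) Y) (sumOver-guard n (p ≤ᵇ a) (_≡ᵇ suc (a ∸ p)) Y) ⟩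
    sumOver n (suc a ≡ᵇ_) (λ b → [ b <ᵇ p ] * Y b) + [ p ≤ᵇ a ] * sumOver n (_≡ᵇ suc (a ∸ p)) Y
      ≡⟨ cong₂ _+_ (sumOver-δ n (suc a) (λ b → [ b <ᵇ p ] * Y b)) (cong (_*_ [ p ≤ᵇ a ]) parent-of-leaf) ⟩
    [ suc a <ᵇ n ] * ([ suc a <ᵇ p ] * Y (suc a)) + [ p ≤ᵇ a ] * ([ suc (a ∸ p) <ᵇ n ] * Y (suc (a ∸ p)))
      ∎
    where
    open ≡-Reasoning
    parent-of-leaf : sumOver n (_≡ᵇ suc (a ∸ p)) Y ≡ [ suc (a ∸ p) <ᵇ n ] * Y (suc (a ∸ p))
    parent-of-leaf = trans (sumOver-cong n _ _ Y (λ b → ≡ᵇ-sym b (suc (a ∸ p)))) (sumOver-δ n (suc (a ∸ p)) Y)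

  childSum-root : ∀ Y → childSum 0 Y ≡ + 0
  childSum-root Y = trans (sumOver-cong n _ (λ _ → false) Y (λ b → ∧-zeroʳ (p ≤ᵇ b))) (sumℤ-zero n)

  childSum-eval : ∀ a Y →
    childSum (suc a) Y ≡ [ suc a <ᵇ p ] * ([ a <ᵇ n ] * Y a) + [ p ℕ.+ a <ᵇ n ] * Y (p ℕ.+ a)
  childSum-eval a Y = begin
    childSum (suc a) Y
      ≡⟨ sumOver-∨ n _ _ Y (λ b → pathEdge-leafEdge-disjoint b (suc a)) ⟩
    sumOver n (λ b → (b ≡ᵇ a) ∧ (suc a <ᵇ p)) Y + sumOver n (λ b → (p ≤ᵇ b) ∧ (a ≡ᵇ b ∸ p)) Y
      ≡⟨ cong₂ _+_ (sumOver-cong n _ _ Y λ b →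
                      trans (∧-comm (b ≡ᵇ a) _) (cong (_∧_ (suc a <ᵇ p)) (≡ᵇ-sym b a)))
                   (sumOver-cong n _ _ Y λ b → ≤ᵇ-∧-≡ᵇ-∸ p b a) ⟩
    sumOver n (λ b → (suc a <ᵇ p) ∧ (a ≡ᵇ b)) Y + sumOver n (p ℕ.+ a ≡ᵇ_) Y
      ≡⟨ cong₂ _+_ (trans (sumOver-guard n (suc a <ᵇ p) (a ≡ᵇ_) Y)
                          (cong (_*_ [ suc a <ᵇ p ]) (sumOver-δ n a Y)))
                   (sumOver-δ n (p ℕ.+ a) Y) ⟩
    [ suc a <ᵇ p ] * ([ a <ᵇ n ] * Y a) + [ p ℕ.+ a <ᵇ n ] * Y (p ℕ.+ a)
      ∎
    where open ≡-Reasoning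

  childSum-leaf : ∀ {j} → j ≤ q → ∀ Y → childSum (p ℕ.+ j) Y ≡ + 0
  childSum-leaf {j} j≤q Y
    rewrite childSum-eval (suc (q ℕ.+ j)) Y
          | <ᵇ-false {p ℕ.+ j} {p} (ℕₚ.m≤m+n p j)
          | <ᵇ-false {p ℕ.+ suc (q ℕ.+ j)} {n} (ℕₚ.+-monoʳ-≤ p (s≤s (ℕₚ.m≤m+n q j)))
    = refl

  childSum-spine : ∀ {j} → j ≤ q → ∀ Y → childSum (suc j) Y ≡ Y j + Y (p ℕ.+ j)
  childSum-spine {j} j≤q Y
    rewrite childSum-eval j Y
          | <ᵇ-true {suc j} {p} (spine<p j≤q)
          | <ᵇ-true (<p⇒<n (ℕₚ.<-trans (ℕₚ.n<1+n j) (spine<p j≤q)))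
          | <ᵇ-true (leaf<n j≤q)
    = simplify (Y j) (Y (p ℕ.+ j))
    where
    simplify : ∀ a b → + 1 * (+ 1 * a) + + 1 * b ≡ a + b
    simplify = solve-∀

  parentSum-root : ∀ Y → parentSum 0 Y ≡ Y 1
  parentSum-root Y rewrite parentSum-eval 0 Y = simplify (Y 1)
    where
    simplify : ∀ a → + 1 * (+ 1 * a) + + 0 ≡ a
    simplify = solve-∀

  parentSum-spine : ∀ {j} → j ≤ q → ∀ Y → parentSum (suc j) Y ≡ [ j <ᵇ q ] * Y (suc (suc j))
  parentSum-spine {j} j≤q Y
    rewrite parentSum-eval (suc j) Y
          | <ᵇ-true (ℕₚ.≤-<-trans (spine<p j≤q) p<n)
          | ≤ᵇ-false {p} {suc j} (spine<p j≤q)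
    = simplify [ j <ᵇ q ] (Y (suc (suc j)))
    where
    simplify : ∀ g a → + 1 * (g * a) + + 0 ≡ g * a
    simplify = solve-∀

  parentSum-leaf : ∀ {j} → j ≤ q → ∀ Y → parentSum (p ℕ.+ j) Y ≡ Y (suc j)
  parentSum-leaf {j} j≤q Y
    rewrite parentSum-eval (p ℕ.+ j) Y
          | <ᵇ-false {suc (p ℕ.+ j)} {p} (ℕₚ.m≤n⇒m≤1+n (ℕₚ.m≤m+n p j))
          | ≤ᵇ-true {p} {p ℕ.+ j} (ℕₚ.m≤m+n p j)
          | ℕₚ.m+n∸m≡n p j
          | <ᵇ-true (<p⇒<n (spine<p j≤q))
    = simplify [ suc (p ℕ.+ j) <ᵇ n ] (Y (suc j))
    where
    simplify : ∀ g a → g * + 0 + + 1 * (+ 1 * a) ≡ a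
    simplify = solve-∀

  neighbourSum-root : ∀ Y → neighbourSum 0 Y ≡ Y 1
  neighbourSum-root Y = begin
    neighbourSum 0 Y              ≡⟨ neighbourSum-split 0 Y ⟩
    parentSum 0 Y + childSum 0 Y  ≡⟨ cong₂ _+_ (parentSum-root Y) (childSum-root Y) ⟩
    Y 1 + + 0                     ≡⟨ ℤₚ.+-identityʳ (Y 1) ⟩
    Y 1                           ∎
    where open ≡-Reasoning

  neighbourSum-spine : ∀ {j} → j ≤ q → ∀ Y →
    neighbourSum (suc j) Y ≡ Y j + Y (p ℕ.+ j) + [ j <ᵇ q ] * Y (suc (suc j))
  neighbourSum-spine {j} j≤q Y = begin
    neighbourSum (suc j) Y
      ≡⟨ neighbourSum-split (suc j) Y ⟩
    parentSum (suc j) Y + childSum (suc j) Y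
      ≡⟨ cong₂ _+_ (parentSum-spine j≤q Y) (childSum-spine j≤q Y) ⟩
    [ j <ᵇ q ] * Y (suc (suc j)) + (Y j + Y (p ℕ.+ j))
      ≡⟨ ℤₚ.+-comm ([ j <ᵇ q ] * Y (suc (suc j))) (Y j + Y (p ℕ.+ j)) ⟩
    Y j + Y (p ℕ.+ j) + [ j <ᵇ q ] * Y (suc (suc j))
      ∎
    where open ≡-Reasoning

  neighbourSum-leaf : ∀ {j} → j ≤ q → ∀ Y → neighbourSum (p ℕ.+ j) Y ≡ Y (suc j)
  neighbourSum-leaf {j} j≤q Y = begin
    neighbourSum (p ℕ.+ j) Y                     ≡⟨ neighbourSum-split (p ℕ.+ j) Y ⟩
    parentSum (p ℕ.+ j) Y + childSum (p ℕ.+ j) Y  ≡⟨ cong₂ _+_ (parentSum-leaf j≤q Y) (childSum-leaf j≤q Y) ⟩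
    Y (suc j) + + 0                             ≡⟨ ℤₚ.+-identityʳ (Y (suc j)) ⟩
    Y (suc j)                                   ∎
    where open ≡-Reasoning

  degree : ℕ → ℕ
  degree a = sumℕ {n} (λ b → b2ℕ (adjacent a (toℕ b)))

  +degree≡neighbourSum : ∀ a → + degree a ≡ neighbourSum a (λ _ → + 1)
  +degree≡neighbourSum a = trans (+-sumℕ {n} (λ b → b2ℕ (adjacent a (toℕ b))))
                                 (sumℤ-cong {n} λ b → sym (ℤₚ.*-identityʳ [ adjacent a (toℕ b) ]))

  degree-root : degree 0 ≡ 1
  degree-root = ℤₚ.+-injective (trans (+degree≡neighbourSum 0) (neighbourSum-root (λ _ → + 1)))

  degree-spine : ∀ {j} → j ≤ q → degree (suc j) ≡ 2 ℕ.+ b2ℕ (j <ᵇ q)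
  degree-spine {j} j≤q = ℤₚ.+-injective (begin
    + degree (suc j)                                ≡⟨ +degree≡neighbourSum (suc j) ⟩
    neighbourSum (suc j) (λ _ → + 1)                ≡⟨ neighbourSum-spine j≤q (λ _ → + 1) ⟩
    + 2 + [ j <ᵇ q ] * + 1                          ≡⟨ cong (_+_ (+ 2)) (ℤₚ.*-identityʳ [ j <ᵇ q ]) ⟩
    + (2 ℕ.+ b2ℕ (j <ᵇ q))                          ∎)
    where open ≡-Reasoning

  degree-leaf : ∀ {j} → j ≤ q → degree (p ℕ.+ j) ≡ 1
  degree-leaf {j} j≤q =
    ℤₚ.+-injective (trans (+degree≡neighbourSum (p ℕ.+ j)) (neighbourSum-leaf j≤q (λ _ → + 1)))

  row : (ℕ → ℤ) → ℕ → ℤ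
  row Y a = + suc (degree a) * Y a - neighbourSum a Y

  reducedLaplacian-row : ∀ (Y : ℕ → ℤ) i →
    sumℤ (λ j → reducedLaplacian (Cone (comb p)) i j * Y (toℕ j)) ≡ row Y (toℕ i)
  reducedLaplacian-row Y i = coneReducedLaplacian-row (comb p) i (Y ∘ toℕ)

  row-root : ∀ Y → row Y 0 ≡ + 2 * Y 0 - Y 1
  row-root Y = cong₂ (λ d s → + suc d * Y 0 - s) degree-root (neighbourSum-root Y)

  row-spine : ∀ {j} → j ≤ q → ∀ Y →
    row Y (suc j) ≡ + suc (degree (suc j)) * Y (suc j) - (Y j + Y (p ℕ.+ j) + [ j <ᵇ q ] * Y (suc (suc j)))
  row-spine {j} j≤q Y = cong (_-_ (+ suc (degree (suc j)) * Y (suc j))) (neighbourSum-spine j≤q Y)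

  row-leaf : ∀ {j} → j ≤ q → ∀ Y → row Y (p ℕ.+ j) ≡ + 2 * Y (p ℕ.+ j) - Y (suc j)
  row-leaf {j} j≤q Y = cong₂ (λ d s → + suc d * Y (p ℕ.+ j) - s) (degree-leaf j≤q) (neighbourSum-leaf j≤q Y)

  -- root is π₁, spine j is π_{j+2} and leaf j is ℓ_{j+1}, the leaf attached to spine j.
  data Vertex : ℕ → Set where
    root  : Vertex 0
    spine : ∀ {j} → j ≤ q → Vertex (suc j)
    leaf  : ∀ {j} → j ≤ q → Vertex (p ℕ.+ j)

  vertex : ∀ {a} → a < n → Vertex a
  vertex {zero}  _   = root
  vertex {suc a} a<n with a ℕₚ.≤? q
  ... | yes a≤q = spine a≤q
  ... | no  a≰q with ℕₚ.m≤n⇒∃[o]m+o≡n (s≤s (ℕₚ.≰⇒> a≰q))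
  ...   | j , refl = leaf (ℕₚ.≤-pred (ℕₚ.+-cancelˡ-< p j (suc q) a<n))

  module ReducedSystem (x : Fin n → ℤ) where

    X : ℕ → ℤ
    X = zeroExtend x

    d : ℕ → ℤ
    d j = + suc (degree (suc j))

    -- Row of π_{i+3} once the spine values are expressed through the leaf values W.
    D R : ℕ → ℤ
    D i = + 2 * d (suc i) - + 1
    R i = X (suc (suc i)) + d (suc i) * X (p ℕ.+ suc i) - X (p ℕ.+ i) - X (p ℕ.+ suc (suc i))

    D-odd : ∀ i → Odd (D i)
    D-odd i = d (suc i) - + 1 , identity (d (suc i))
      where
      identity : ∀ a → + 2 * a - + 1 ≡ + 1 + + 2 * (a - + 1)
      identity = solve-∀

    tridiagonal-solution : Σ (ℕ → ℤ) (SolvesTridiagonal q D R)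
    tridiagonal-solution = tridiagonal-solvable q D R D-odd

  module Preimage (x : Fin n → ℤ) (W : ℕ → ℤ) (W-end : W (suc q) ≡ + 0)
                  (W-rows : ∀ i → i < q → TridiagonalRow (ReducedSystem.D x) (ReducedSystem.R x) W i) where
    open ReducedSystem x

    -- Forced by the row of ℓ_{j+1}: 2 W j - y(π_{j+2}) = X (p + j).
    spineValue : ℕ → ℤ
    spineValue j = + 2 * W j - X (p ℕ.+ j)

    -- Forced by the row of π₂; the row of π₁ then only determines c.
    rootValue : ℤ
    rootValue = d 0 * spineValue 0 - spineValue 1 - W 0 - X 1

    pathValue : ℕ → ℤ
    pathValue zero    = rootValue
    pathValue (suc j) = spineValue j

    Y : ℕ → ℤ
    Y a = if a <ᵇ p then pathValue a else W (a ∸ p)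

    c : ℤ
    c = X 0 - (+ 2 * rootValue - spineValue 0)

    Y-path : ∀ {a} → a < p → Y a ≡ pathValue a
    Y-path {a} a<p = cong (if_then pathValue a else W (a ∸ p)) (<ᵇ-true a<p)

    Y-leaf : ∀ j → Y (p ℕ.+ j) ≡ W j
    Y-leaf j = trans (cong (if_then pathValue (p ℕ.+ j) else W (p ℕ.+ j ∸ p)) (<ᵇ-false (ℕₚ.m≤m+n p j)))
                     (cong W (ℕₚ.m+n∸m≡n p j))

    -- At the top spine vertex (j = q) there is no vertex above, and spineValue (suc q)
    -- vanishes because W (suc q) = 0 and x is extended by zero beyond n.
    Y-above : ∀ {j} → j ≤ q → [ j <ᵇ q ] * Y (suc (suc j)) ≡ spineValue (suc j)
    Y-above {j} j≤q with ℕₚ.m≤n⇒m<n∨m≡n j≤q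
    ... | inj₁ j<q = trans (cong (λ b → [ b ] * Y (suc (suc j))) (<ᵇ-true j<q))
                           (trans (ℤₚ.*-identityˡ _) (Y-path (s≤s (s≤s j<q))))
    ... | inj₂ refl = trans (cong (λ b → [ b ] * Y (suc (suc q))) (<ᵇ-false (ℕₚ.≤-refl {q})))
                            (sym (cong₂ (λ w l → + 2 * w - l) W-end (zeroExtend-≥ x ℕₚ.≤-refl)))

    spine-equation : ∀ {j} → j ≤ q → d j * spineValue j - (pathValue j + W j + spineValue (suc j)) ≡ X (suc j)
    spine-equation {zero}  _         = cancel (d 0) (spineValue 0) (spineValue 1) (W 0) (X 1)
      where
      cancel : ∀ a s₀ s₁ w x → a * s₀ - ((a * s₀ - s₁ - w - x) + w + s₁) ≡ x
      cancel = solve-∀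
    spine-equation {suc i} i<q = eliminate (d (suc i)) (W i) (W (suc i)) (W (suc (suc i)))
      (X (p ℕ.+ i)) (X (p ℕ.+ suc i)) (X (p ℕ.+ suc (suc i))) (X (suc (suc i))) (W-rows i i<q)
      where
      eliminate : ∀ δ w₀ w₁ w₂ l₀ l₁ l₂ x →
        (+ 2 * δ - + 1) * w₁ - + 2 * w₀ - + 2 * w₂ ≡ x + δ * l₁ - l₀ - l₂ →
        δ * (+ 2 * w₁ - l₁) - ((+ 2 * w₀ - l₀) + w₁ + (+ 2 * w₂ - l₂)) ≡ x
      eliminate δ w₀ w₁ w₂ l₀ l₁ l₂ x row-eq = begin
        δ * (+ 2 * w₁ - l₁) - ((+ 2 * w₀ - l₀) + w₁ + (+ 2 * w₂ - l₂))
          ≡⟨ regroup δ w₀ w₁ w₂ l₀ l₁ l₂ ⟩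
        ((+ 2 * δ - + 1) * w₁ - + 2 * w₀ - + 2 * w₂) - (δ * l₁ - l₀ - l₂)
          ≡⟨ cong (_- (δ * l₁ - l₀ - l₂)) row-eq ⟩
        (x + δ * l₁ - l₀ - l₂) - (δ * l₁ - l₀ - l₂)
          ≡⟨ cancel x δ l₀ l₁ l₂ ⟩
        x ∎
        where
        open ≡-Reasoning
        regroup : ∀ δ w₀ w₁ w₂ l₀ l₁ l₂ →
          δ * (+ 2 * w₁ - l₁) - ((+ 2 * w₀ - l₀) + w₁ + (+ 2 * w₂ - l₂))
            ≡ ((+ 2 * δ - + 1) * w₁ - + 2 * w₀ - + 2 * w₂) - (δ * l₁ - l₀ - l₂)
        regroup = solve-∀
        cancel : ∀ x δ l₀ l₁ l₂ → (x + δ * l₁ - l₀ - l₂) - (δ * l₁ - l₀ - l₂) ≡ x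
        cancel = solve-∀

    solves-row : ∀ {a} → Vertex a → row Y a ≡ X a - c * [ a ≡ᵇ 0 ]
    solves-row root = trans (row-root Y) (absorb (X 0) rootValue (spineValue 0))
      where
      absorb : ∀ x u v → + 2 * u - v ≡ x - (x - (+ 2 * u - v)) * + 1
      absorb = solve-∀
    solves-row (spine {j} j≤q) = begin
      row Y (suc j)
        ≡⟨ row-spine j≤q Y ⟩
      d j * Y (suc j) - (Y j + Y (p ℕ.+ j) + [ j <ᵇ q ] * Y (suc (suc j)))
        ≡⟨ cong₂ (λ s t → d j * s - t) (Y-path (spine<p j≤q))
             (cong₂ _+_ (cong₂ _+_ (Y-path (ℕₚ.<-trans (ℕₚ.n<1+n j) (spine<p j≤q))) (Y-leaf j))
                        (Y-above j≤q)) ⟩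
      d j * spineValue j - (pathValue j + W j + spineValue (suc j))
        ≡⟨ spine-equation j≤q ⟩
      X (suc j)
        ≡⟨ sym (subtract-zero (X (suc j)) c) ⟩
      X (suc j) - c * + 0 ∎
      where
      open ≡-Reasoning
      subtract-zero : ∀ x c → x - c * + 0 ≡ x
      subtract-zero = solve-∀
    solves-row (leaf {j} j≤q) = begin
      row Y (p ℕ.+ j)                       ≡⟨ row-leaf j≤q Y ⟩
      + 2 * Y (p ℕ.+ j) - Y (suc j)         ≡⟨ cong₂ (λ w s → + 2 * w - s) (Y-leaf j) (Y-path (spine<p j≤q)) ⟩
      + 2 * W j - (+ 2 * W j - X (p ℕ.+ j)) ≡⟨ cancel (W j) (X (p ℕ.+ j)) c ⟩
      X (p ℕ.+ j) - c * + 0                 ∎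
      where
      open ≡-Reasoning
      cancel : ∀ w l c → + 2 * w - (+ 2 * w - l) ≡ l - c * + 0
      cancel = solve-∀

    solves : ∀ i → sumℤ (λ j → reducedLaplacian (Cone (comb p)) i j * Y (toℕ j))
                   ≡ x i - (c * [ toℕ i ≡ᵇ 0 ] + + 0)
    solves i = begin
      sumℤ (λ j → reducedLaplacian (Cone (comb p)) i j * Y (toℕ j))
        ≡⟨ reducedLaplacian-row Y i ⟩
      row Y (toℕ i)
        ≡⟨ solves-row (vertex (Finₚ.toℕ<n i)) ⟩
      X (toℕ i) - c * [ toℕ i ≡ᵇ 0 ]
        ≡⟨ cong₂ _-_ (zeroExtend-toℕ x i) (sym (ℤₚ.+-identityʳ _)) ⟩
      x i - (c * [ toℕ i ≡ᵇ 0 ] + + 0)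
        ∎
      where open ≡-Reasoning

  generated-by-one : SandpileGeneratedBy (Cone (comb p)) 1
  generated-by-one = (λ _ i → [ toℕ i ≡ᵇ 0 ]) , λ x →
    let W , W-end , W-rows = ReducedSystem.tridiagonal-solution x
        open Preimage x W W-end W-rows
    in (λ _ → c) , Y ∘ toℕ , solves

  not-generated-by-zero : ¬ SandpileGeneratedBy (Cone (comb p)) 0
  not-generated-by-zero (_ , generates) with generates (λ i → [ toℕ i ≡ᵇ 0 ])
  ... | _ , y , y-solves = 2*-≢-1 (Y 0 - Y (p ℕ.+ 0)) (begin
    + 2 * (Y 0 - Y (p ℕ.+ 0))                      ≡⟨ difference (Y 0) (Y (p ℕ.+ 0)) (Y 1) ⟩
    (+ 2 * Y 0 - Y 1) - (+ 2 * Y (p ℕ.+ 0) - Y 1)   ≡⟨ cong₂ _-_ root-row leaf-row ⟩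
    + 1                                            ∎)
    where
    open ≡-Reasoning
    Y : ℕ → ℤ
    Y = zeroExtend y
    row-is-indicator : ∀ i a → toℕ i ≡ a → row Y a ≡ [ a ≡ᵇ 0 ] - + 0
    row-is-indicator i a refl = trans (sym (reducedLaplacian-row Y i))
      (trans (sumℤ-cong λ j → cong (_*_ (reducedLaplacian (Cone (comb p)) i j)) (zeroExtend-toℕ y j)) (y-solves i))
    root-row : + 2 * Y 0 - Y 1 ≡ + 1
    root-row = trans (sym (row-root Y)) (row-is-indicator zero 0 refl)
    leaf-row : + 2 * Y (p ℕ.+ 0) - Y 1 ≡ + 0
    leaf-row = trans (sym (row-leaf z≤n Y)) (row-is-indicator (p ↑ʳ zero) (p ℕ.+ 0) (Finₚ.toℕ-↑ʳ p zero))
    difference : ∀ u v w → + 2 * (u - v) ≡ (+ 2 * u - w) - (+ 2 * v - w)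
    difference = solve-∀

  μ-cone-comb : μ≡ (Cone (comb p)) 1
  μ-cone-comb = generated-by-one , λ where
    zero    _         → not-generated-by-zero
    (suc _) (s≤s ())

  isLeaf : ℕ → ℕ
  isLeaf a = b2ℕ (degree a ≡ᵇ 1)

  numLeaves-comb : numLeaves (comb p) ≡ p
  numLeaves-comb = begin
    numLeaves (comb p)
      ≡⟨ sumℕ-split p isLeaf ⟩
    (isLeaf 0 ℕ.+ sumℕ {suc q} (λ v → isLeaf (suc (toℕ v))))
      ℕ.+ sumℕ {suc q} (λ v → isLeaf (p ℕ.+ toℕ v))
      ≡⟨ cong₂ ℕ._+_ (cong₂ ℕ._+_ (cong (λ k → b2ℕ (k ≡ᵇ 1)) degree-root) no-spine-leaves)
                     all-leaves ⟩
    1 ℕ.+ 0 ℕ.+ suc q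
      ∎
    where
    open ≡-Reasoning
    bound : (v : Fin (suc q)) → toℕ v ≤ q
    bound v = ℕₚ.≤-pred (Finₚ.toℕ<n v)
    no-spine-leaves : sumℕ {suc q} (λ v → isLeaf (suc (toℕ v))) ≡ 0
    no-spine-leaves = trans (sumℕ-cong λ v → cong (λ k → b2ℕ (k ≡ᵇ 1)) (degree-spine (bound v)))
                            (trans (sumℕ-const (suc q) 0) (ℕₚ.*-zeroʳ q))
    all-leaves : sumℕ {suc q} (λ v → isLeaf (p ℕ.+ toℕ v)) ≡ suc q
    all-leaves = trans (sumℕ-cong λ v → cong (λ k → b2ℕ (k ≡ᵇ 1)) (degree-leaf (bound v)))
                       (trans (sumℕ-const (suc q) 1) (ℕₚ.*-identityʳ (suc q)))

theorem1p7 : (p : ℕ) → 2 ≤ p → μ≡ (Cone (comb p)) 1 × numLeaves (comb p) ≡ p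
theorem1p7 (suc (suc q)) (s≤s (s≤s z≤n)) = μ-cone-comb , numLeaves-comb
  where open Comb q
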